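{- For every planar binary tree $r\in\mathcal{Y}_n$, the coproduct of $\mathcal{Y}Sym$ satisfies $$\Delta(M_r)=\sum_{r=s\backslash t}M_s\otimes M_t,$$ the sum over all pairs of planar binary trees $(s,t)$ with $s\backslash t=r$.
   Context: $\mathcal{Y}_n$: rooted planar binary trees with $n$ internal nodes, $\mathcal{Y}_0=\{|\}$; each $t\in\mathcal{Y}_n$, $n\geq1$, is uniquely $t_l\vee t_r$ (grafting onto the two leaves of the one-node tree). Tamari order: generated by replacing a subtree $(A\vee B)\vee C$ by $A\vee(B\vee C)$. Define $|\backslash t=t$, $s\backslash t=s_l\vee(s_r\backslash t)$ (graft root of $t$ onto the rightmost leaf of $s$). Permutations: $\mathfrak{S}_n$; $\sigma\vee\tau$ has values $\sigma(1)+q,\dots,\sigma(p)+q,p+q+1,\tau(1),\dots,\tau(q)$; $\mathrm{st}$ = standardization. $\lambda(\mathrm{id}_0)=|$, $\lambda(\sigma)=\lambda(\mathrm{st}(\sigma(1..j-1)))\vee\lambda(\mathrm{st}(\sigma(j+1..n)))$ with $j=\sigma^{ -1}(n)$; $\gamma(|)=\mathrm{id}_0$, $\gamma(t)=\gamma(t_l)\vee\gamma(t_r)$. $\mathcal{Y}Sym$ is the graded Hopf algebra over $\mathbb{Q}$ with basis $\{F_t\}$ (the graded dual of the Loday–Ronco algebra); its coproduct is $\Delta(F_t)=\sum_{i=0}^nF_{\lambda(\mathrm{st}(\gamma(t)(1),\dots,\gamma(t)(i)))}\otimes F_{\lambda(\mathrm{st}(\gamma(t)(i+1),\dots,\gamma(t)(n)))}$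 for $t\in\mathcal{Y}_n$ (equivalently, sum over all ways of splitting $t$ along the path from a leaf to the root). The monomial basis is $M_t=\sum_{s\geq t}\mu_{\mathcal{Y}_n}(t,s)F_s$ with $\mu_{\mathcal{Y}_n}$ the Möbius function of the Tamari order. -}

module Defs where

open import Data.Nat as ℕ using (ℕ; zero; suc; _∸_; _≤?_)
open import Data.List using (List; []; _∷_; _++_; map; concatMap; length; filter; take; drop; upTo; foldr; span)
open import Data.Product using (_×_; _,_; proj₁; proj₂)
open import Data.Rational using (ℚ; 0ℚ; 1ℚ; _+_; _*_)
open import Relation.Binary.PropositionalEquality using (_≡_; refl; cong₂)
open import Relation.Nullary using (Dec; yes; no; ¬_; ¬?)
open import Relation.Binary.Construct.Closure.ReflexiveTransitive using (Star)

infixr 5 _∨_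
data Tree : Set where
  leaf : Tree
  _∨_  : Tree → Tree → Tree

-- number of internal nodes: t ∈ 𝒴_n  iff  size t ≡ n
size : Tree → ℕ
size leaf = 0
size (l ∨ r) = suc (size l ℕ.+ size r)

∨-injˡ : ∀ {a b c d} → a ∨ b ≡ c ∨ d → a ≡ c
∨-injˡ refl = refl

∨-injʳ : ∀ {a b c d} → a ∨ b ≡ c ∨ d → b ≡ d
∨-injʳ refl = refl

_≟T_ : (s t : Tree) → Dec (s ≡ t)
leaf ≟T leaf = yes refl
leaf ≟T (_ ∨ _) = no (λ ())
(_ ∨ _) ≟T leaf = no (λ ())
(a ∨ b) ≟T (c ∨ d) with a ≟T c | b ≟T d
... | yes p | yes q = yes (cong₂ _∨_ p q)
... | no ¬p | _ = no (λ e → ¬p (∨-injˡ e))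
... | yes _ | no ¬q = no (λ e → ¬q (∨-injʳ e))

-- s \ t : graft the root of t onto the rightmost leaf of s
_＼_ : Tree → Tree → Tree
leaf ＼ t = t
(sl ∨ sr) ＼ t = sl ∨ (sr ＼ t)

-- enumeration of 𝒴_n (with fuel k; fuel n+1 suffices)
treesF : ℕ → ℕ → List Tree
treesF _ zero = leaf ∷ []
treesF zero (suc n) = []
treesF (suc k) (suc n) =
  concatMap (λ i → concatMap (λ l → map (λ r → l ∨ r) (treesF k (n ∸ i))) (treesF k i))
            (upTo (suc n))

𝒴 : ℕ → List Tree
𝒴 n = treesF (suc n) n

data _⇒_ : Tree → Tree → Set where
  rot   : ∀ A B C → ((A ∨ B) ∨ C) ⇒ (A ∨ (B ∨ C))
  left  : ∀ {s s'} t → s ⇒ s' → (s ∨ t) ⇒ (s' ∨ t)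
  right : ∀ s {t t'} → t ⇒ t' → (s ∨ t) ⇒ (s ∨ t')

_≤T_ : Tree → Tree → Set
_≤T_ = Star _⇒_

-- Permutations as lists of values 1..n

_∨ₚ_ : List ℕ → List ℕ → List ℕ
σ ∨ₚ τ = map (λ x → x ℕ.+ q) σ ++ ((suc (length σ ℕ.+ q)) ∷ τ)
  where q = length τ

st : List ℕ → List ℕ
st w = map (λ x → length (filter (λ y → y ≤? x) w)) w

γ : Tree → List ℕ
γ leaf = []
γ (l ∨ r) = γ l ∨ₚ γ r

-- λ(σ) = λ(st(σ(1..j-1))) ∨ λ(st(σ(j+1..n))), j = σ⁻¹(n); fuel k ≥ length σ
λF : ℕ → List ℕ → Tree
λF zero _ = leaf
λF (suc k) [] = leaf
λF (suc k) σ@(_ ∷ _) with span (λ x → ¬? (x ℕ.≟ length σ)) σ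
... | (pre , post) = λF k (st pre) ∨ λF k (st (drop 1 post))

λₚ : List ℕ → Tree
λₚ σ = λF (length σ) σ

-- Elements of 𝒴Sym ⊗ 𝒴Sym as finite formal ℚ-combinations of F_s ⊗ F_t

Tensor : Set
Tensor = List (ℚ × Tree × Tree)

sumℚ : List ℚ → ℚ
sumℚ = foldr _+_ 0ℚ

δ : Tree → Tree → ℚ
δ s t with s ≟T t
... | yes _ = 1ℚ
... | no _ = 0ℚ

coeff : Tensor → Tree → Tree → ℚ
coeff x a b = sumℚ (map (λ { (c , s , t) → c * δ s a * δ t b }) x)

scale : ℚ → Tensor → Tensor
scale c = map (λ { (d , s , t) → (c * d , s , t) })

ΔF : Tree → Tensor
ΔF t = map (λ i → (1ℚ , λₚ (st (take i σ)) , λₚ (st (drop i σ)))) (upTo (suc (size t)))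
  where σ = γ t

-- Zeta and Möbius functions of the Tamari order (specified by their
-- defining properties; ζ(a,b) = [a ≤ b], μ = ζ⁻¹ on each 𝒴_n).

IsZeta : (Tree → Tree → ℚ) → Set
IsZeta ζ = ∀ a b → (a ≤T b → ζ a b ≡ 1ℚ) × (¬ (a ≤T b) → ζ a b ≡ 0ℚ)

IsMöbius : (Tree → Tree → ℚ) → (Tree → Tree → ℚ) → Set
IsMöbius ζ μ = ∀ t s → size t ≡ size s →
  sumℚ (map (λ u → μ t u * ζ u s) (𝒴 (size t))) ≡ δ t s

module _ (ζ μ : Tree → Tree → ℚ) where

  -- M_t = Σ_{s ≥ t} μ(t,s) F_s , as list of (coefficient, tree)
  M : Tree → List (ℚ × Tree)
  M t = map (λ s → (μ t s * ζ t s , s)) (𝒴 (size t))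

  ΔM : Tree → Tensor
  ΔM r = concatMap (λ { (c , u) → scale c (ΔF u) }) (M r)

  M⊗M : Tree → Tree → Tensor
  M⊗M s t = concatMap (λ { (c , s') → map (λ { (d , t') → (c * d , s' , t') }) (M t) }) (M s)

  -- all pairs (s,t) with s \ t = r (necessarily size s + size t = size r)
  pairs＼ : Tree → List (Tree × Tree)
  pairs＼ r = filter (λ { (s , t) → (s ＼ t) ≟T r })
    (concatMap (λ i → concatMap (λ s → map (λ t → (s , t)) (𝒴 (size r ∸ i))) (𝒴 i))
               (upTo (suc (size r))))

  RHS : Tree → Tensor
  RHS r = concatMap (λ { (s , t) → M⊗M s t }) (pairs＼ r)

{-# OPTIONS --safe #-}
module Submission where

-- Cutting a tree u along the path from its i-th leaf to the root gives a pair
-- cut u i = (u'ᵢ , u''ᵢ), and Δ(F_u) = Σᵢ F_{u'ᵢ} ⊗ F_{u''ᵢ}: the permutation formula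
-- for Δ computes exactly these cuts, because u is the decreasing tree of γ(u).
-- Cutting at |s| is left adjoint to grafting: cut u |s| ≤ (s , t) componentwise
-- iff u ≤ s \ t. Now pair a tensor Σ c F_s ⊗ F_t with ζ ⊗ ζ, i.e. send it to
-- (a , b) ↦ Σ c ζ(s,a) ζ(t,b). The adjunction sends Δ(F_u) to ζ(u, a \ b), so by
-- Möbius inversion Δ(M_r) goes to δ(r, a \ b); since M_s pairs with ζ(−, a) to
-- δ(s, a), the right-hand side goes to the same value. The pairing is injective
-- because ζ ⊗ ζ is unitriangular for the rank Σ_nodes |right subtree|, which every
-- rotation increases.

open import Defs
open import Data.Rational using (ℚ; 0ℚ; 1ℚ; _+_; _*_; -_)
import Data.Rational.Properties as ℚ
open import Data.Rational.Solver using (module +-*-Solver)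

open import Data.Nat as ℕ using (ℕ; zero; suc; _∸_; _≤_; _<_; _≤?_; _<?_; z≤n; s≤s; s≤s⁻¹)
open import Data.Nat.Induction using (<-wellFounded)
open import Data.Nat.Properties
  using (≤-refl; ≤-trans; <-trans; <-cmp; <⇒≤; <⇒≢; >⇒≢; <⇒≱; ≰⇒>; n≮n; n<1+n; n≤1+n; m≤n⇒m≤1+n;
         m≤m+n; m≤n+m; m+n≮m; m∸n≤m; m+n∸m≡n; m+[n∸m]≡n; suc-injective; +-suc; +-assoc;
         +-monoˡ-≤; +-monoʳ-≤; +-monoˡ-<; +-monoʳ-<; +-mono-<; +-cancelˡ-≤)
open import Data.Nat.Tactic.RingSolver using (solve-∀)
open import Data.List
  using (List; []; _∷_; _++_; _∷ʳ_; [_]; map; concatMap; filter; length; take; drop; span; upTo)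
open import Data.List.Properties
  using (map-++; map-∘; map-cong; map-cong-local; applyUpTo-∷ʳ; length-map; length-++;
         filter-all; filter-notAll; filter-accept; filter-reject)
open import Data.List.Relation.Unary.All as All using (All; []; _∷_)
open import Data.List.Relation.Unary.All.Properties using (map⁺; ++⁺; take⁺; drop⁺; applyUpTo⁺₁)
open import Data.List.Relation.Unary.Any as Any using (here; there)
open import Data.List.Membership.Propositional using (_∈_)
open import Data.List.Membership.Propositional.Properties using (∈-++⁺ˡ; ∈-++⁺ʳ)
open import Data.List.Relation.Binary.Subset.Propositional using (_⊆_)
open import Data.Product using (_×_; _,_; proj₁; proj₂; map₁; map₂)
open import Data.Product.Relation.Binary.Pointwise.NonDependent using (Pointwise)
open import Data.Sum using (_⊎_; inj₁; inj₂)
open import Function using (id; _∘_; flip; _⇔_; mk⇔; Equivalence)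
open import Induction.WellFounded using (Acc; acc)
open import Relation.Binary.Core using (_Preserves_⟶_)
open import Relation.Binary.Definitions using (tri<; tri≈; tri>)
open import Relation.Binary.PropositionalEquality
  using (_≡_; _≢_; refl; sym; trans; cong; cong₂; subst; module ≡-Reasoning)
open import Relation.Binary.Construct.Closure.ReflexiveTransitive using (ε; _◅_; _◅◅_; gmap)
open import Relation.Nullary using (Dec; yes; no; ¬_; ¬?; contradiction; _×-dec_)
open import Relation.Nullary.Decidable using (decidable-stable)
open import Relation.Unary using (Decidable)

-- Tamari order

size-⇒ : ∀ {s t} → s ⇒ t → size s ≡ size t
size-⇒ (rot A B C) = cong suc (trans (+-assoc (suc (size A)) (size B) (size C)) (sym (+-suc (size A) _)))
size-⇒ (left t p) = cong (λ n → suc (n ℕ.+ size t)) (size-⇒ p)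
size-⇒ (right s p) = cong (λ n → suc (size s ℕ.+ n)) (size-⇒ p)

size-≤T : ∀ {s t} → s ≤T t → size s ≡ size t
size-≤T ε = refl
size-≤T (p ◅ ps) = trans (size-⇒ p) (size-≤T ps)

rank : Tree → ℕ
rank leaf = 0
rank (l ∨ r) = rank l ℕ.+ rank r ℕ.+ size r

rank-rot : ∀ A B C → rank (A ∨ (B ∨ C)) ≡ suc (rank ((A ∨ B) ∨ C) ℕ.+ size C)
rank-rot A B C = regroup (rank A) (rank B) (rank C) (size B) (size C)
  where
  regroup : ∀ a b c m n →
            a ℕ.+ (b ℕ.+ c ℕ.+ n) ℕ.+ suc (m ℕ.+ n) ≡ suc (a ℕ.+ b ℕ.+ m ℕ.+ c ℕ.+ n ℕ.+ n)
  regroup = solve-∀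

rank-⇒ : ∀ {s t} → s ⇒ t → rank s < rank t
rank-⇒ (rot A B C) = subst (rank ((A ∨ B) ∨ C) <_) (sym (rank-rot A B C)) (s≤s (m≤m+n _ (size C)))
rank-⇒ (left t p) = +-monoˡ-< (size t) (+-monoˡ-< (rank t) (rank-⇒ p))
rank-⇒ (right s {t} {t'} p) =
  subst (λ n → rank s ℕ.+ rank t ℕ.+ size t < rank s ℕ.+ rank t' ℕ.+ n) (size-⇒ p)
    (+-monoˡ-< (size t) (+-monoʳ-< (rank s) (rank-⇒ p)))

≤T⇒≡⊎rank< : ∀ {s t} → s ≤T t → s ≡ t ⊎ rank s < rank t
≤T⇒≡⊎rank< ε = inj₁ refl
≤T⇒≡⊎rank< (p ◅ ps) with ≤T⇒≡⊎rank< ps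
... | inj₁ refl = inj₂ (rank-⇒ p)
... | inj₂ lt = inj₂ (<-trans (rank-⇒ p) lt)

rank-+-< : ∀ {s a t b} → s ≤T a → t ≤T b → ¬ (s ≡ a × t ≡ b) →
           rank s ℕ.+ rank t < rank a ℕ.+ rank b
rank-+-< s≤a t≤b ≢ with ≤T⇒≡⊎rank< s≤a | ≤T⇒≡⊎rank< t≤b
... | inj₁ refl | inj₁ refl = contradiction (refl , refl) ≢
... | inj₁ refl | inj₂ t<b = +-monoʳ-< _ t<b
... | inj₂ s<a | inj₁ refl = +-monoˡ-< _ s<a
... | inj₂ s<a | inj₂ t<b = +-mono-< s<a t<b

∨-monoˡ : ∀ {s s'} t → s ≤T s' → (s ∨ t) ≤T (s' ∨ t)
∨-monoˡ t = gmap (_∨ t) (left t)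

∨-monoʳ : ∀ s {t t'} → t ≤T t' → (s ∨ t) ≤T (s ∨ t')
∨-monoʳ s = gmap (s ∨_) (right s)

＼-⇒ˡ : ∀ {s s'} t → s ⇒ s' → (s ＼ t) ⇒ (s' ＼ t)
＼-⇒ˡ t (rot A B C) = rot A B (C ＼ t)
＼-⇒ˡ t (left r p) = left (r ＼ t) p
＼-⇒ˡ t (right s p) = right s (＼-⇒ˡ t p)

＼-monoʳ : ∀ s {t t'} → t ≤T t' → (s ＼ t) ≤T (s ＼ t')
＼-monoʳ leaf p = p
＼-monoʳ (sl ∨ sr) p = ∨-monoʳ sl (＼-monoʳ sr p)

＼-mono : ∀ {s s' t t'} → s ≤T s' → t ≤T t' → (s ＼ t) ≤T (s' ＼ t')
＼-mono {s' = s'} {t = t} p q = gmap (_＼ t) (＼-⇒ˡ t) p ◅◅ ＼-monoʳ s' q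

∨-＼-≤T : ∀ s t r → ((s ＼ t) ∨ r) ≤T (s ＼ (t ∨ r))
∨-＼-≤T leaf t r = ε
∨-＼-≤T (sl ∨ sr) t r = rot sl (sr ＼ t) r ◅ ∨-monoʳ sl (∨-＼-≤T sr t r)

size-＼ : ∀ s t → size (s ＼ t) ≡ size s ℕ.+ size t
size-＼ leaf t = refl
size-＼ (sl ∨ sr) t =
  cong suc (trans (cong (size sl ℕ.+_) (size-＼ sr t)) (sym (+-assoc (size sl) (size sr) (size t))))

-- Cutting along a leaf-to-root path

cut : Tree → ℕ → Tree × Tree
cut leaf i = leaf , leaf
cut (l ∨ r) i with i ≤? size l
... | yes _ = map₂ (_∨ r) (cut l i)
... | no _ = map₁ (l ∨_) (cut r (i ∸ suc (size l)))

data Compare≤ (n : ℕ) : ℕ → Set where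
  below : ∀ {i} → i ≤ n → Compare≤ n i
  above : ∀ j → Compare≤ n (suc (n ℕ.+ j))

compare≤ : ∀ n i → Compare≤ n i
compare≤ n i with i ≤? n
... | yes i≤n = below i≤n
... | no i≰n = subst (Compare≤ n) (m+[n∸m]≡n (≰⇒> i≰n)) (above (i ∸ suc n))

cut-∨-below : ∀ {i} l r → i ≤ size l → cut (l ∨ r) i ≡ map₂ (_∨ r) (cut l i)
cut-∨-below {i} l r i≤ with i ≤? size l
... | yes _ = refl
... | no i≰ = contradiction i≤ i≰

cut-∨-above : ∀ l r j → cut (l ∨ r) (suc (size l ℕ.+ j)) ≡ map₁ (l ∨_) (cut r j)
cut-∨-above l r j with suc (size l ℕ.+ j) ≤? size l
... | yes i≤ = contradiction i≤ (m+n≮m (size l) j)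
... | no _ = cong (λ k → map₁ (l ∨_) (cut r k)) (m+n∸m≡n (size l) j)

size-cut : ∀ u {i} → i ≤ size u → size (proj₁ (cut u i)) ≡ i
size-cut leaf z≤n = refl
size-cut (l ∨ r) {i} i≤ with compare≤ (size l) i
... | below i≤l rewrite cut-∨-below l r i≤l = size-cut l i≤l
... | above j rewrite cut-∨-above l r j =
  cong (λ n → suc (size l ℕ.+ n)) (size-cut r (+-cancelˡ-≤ (size l) _ _ (s≤s⁻¹ i≤)))

cut-0 : ∀ t → cut t 0 ≡ (leaf , t)
cut-0 leaf = refl
cut-0 (l ∨ r) = trans (cut-∨-below l r z≤n) (cong (map₂ (_∨ r)) (cut-0 l))

cut-＼ : ∀ s t → cut (s ＼ t) (size s) ≡ (s , t)
cut-＼ leaf t = cut-0 t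
cut-＼ (sl ∨ sr) t = trans (cut-∨-above sl (sr ＼ t) (size sr)) (cong (map₁ (sl ∨_)) (cut-＼ sr t))

≤T-＼-cut : ∀ u i → u ≤T (proj₁ (cut u i) ＼ proj₂ (cut u i))
≤T-＼-cut leaf i = ε
≤T-＼-cut (l ∨ r) i with compare≤ (size l) i
... | below i≤l rewrite cut-∨-below l r i≤l =
  ∨-monoˡ r (≤T-＼-cut l i) ◅◅ ∨-＼-≤T (proj₁ (cut l i)) (proj₂ (cut l i)) r
... | above j rewrite cut-∨-above l r j = ∨-monoʳ l (≤T-＼-cut r j)

infix 4 _≤²_
_≤²_ : Tree × Tree → Tree × Tree → Set
_≤²_ = Pointwise _≤T_ _≤T_

+-suc-assoc : ∀ a b k → a ℕ.+ suc (b ℕ.+ k) ≡ suc (a ℕ.+ b) ℕ.+ k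
+-suc-assoc a b k = trans (+-suc a (b ℕ.+ k)) (cong suc (sym (+-assoc a b k)))

cut-mono-⇒ : ∀ {u u'} → u ⇒ u' → ∀ i → cut u i ≤² cut u' i
cut-mono-⇒ (rot A B C) i with compare≤ (size A) i
... | below i≤A
  rewrite cut-∨-below (A ∨ B) C (m≤n⇒m≤1+n (≤-trans i≤A (m≤m+n (size A) (size B))))
        | cut-∨-below A B i≤A | cut-∨-below A (B ∨ C) i≤A = ε , rot _ B C ◅ ε
... | above j with compare≤ (size B) j
...   | below j≤B
  rewrite cut-∨-below (A ∨ B) C (s≤s (+-monoʳ-≤ (size A) j≤B))
        | cut-∨-above A B j | cut-∨-above A (B ∨ C) j | cut-∨-below B C j≤B = ε , ε
...   | above k
  rewrite cut-∨-above A (B ∨ C) (suc (size B ℕ.+ k)) | cut-∨-above B C k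
        | trans (cong (λ n → cut ((A ∨ B) ∨ C) (suc n)) (+-suc-assoc (size A) (size B) k))
                (cut-∨-above (A ∨ B) C k) = rot A B _ ◅ ε , ε
cut-mono-⇒ (left {s} {s'} t p) i with compare≤ (size s) i
... | below i≤s
  rewrite cut-∨-below s t i≤s | cut-∨-below s' t (subst (i ≤_) (size-⇒ p) i≤s) =
  let ih = cut-mono-⇒ p i in proj₁ ih , ∨-monoˡ t (proj₂ ih)
... | above j rewrite cut-∨-above s t j | size-⇒ p | cut-∨-above s' t j = left _ p ◅ ε , ε
cut-mono-⇒ (right s {t} {t'} p) i with compare≤ (size s) i
... | below i≤s rewrite cut-∨-below s t i≤s | cut-∨-below s t' i≤s = ε , right _ p ◅ ε
... | above j rewrite cut-∨-above s t j | cut-∨-above s t' j =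
  let ih = cut-mono-⇒ p j in ∨-monoʳ s (proj₁ ih) , proj₂ ih

cut-mono : ∀ {u u'} → u ≤T u' → ∀ i → cut u i ≤² cut u' i
cut-mono ε i = ε , ε
cut-mono (p ◅ ps) i =
  let (l₁ , r₁) = cut-mono-⇒ p i ; (l₂ , r₂) = cut-mono ps i in l₁ ◅◅ l₂ , r₁ ◅◅ r₂

cut-galois : ∀ u s t → u ≤T (s ＼ t) ⇔ cut u (size s) ≤² (s , t)
cut-galois u s t = mk⇔
  (λ u≤ → subst (cut u (size s) ≤²_) (cut-＼ s t) (cut-mono u≤ (size s)))
  (λ (l≤ , r≤) → ≤T-＼-cut u (size s) ◅◅ ＼-mono l≤ r≤)

-- Standardization and decreasing trees

length-++-∷ : ∀ {A : Set} (xs : List A) y ys → length (xs ++ y ∷ ys) ≡ suc (length xs ℕ.+ length ys)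
length-++-∷ xs y ys = trans (length-++ xs) (+-suc (length xs) (length ys))

span-at : ∀ {A : Set} {P : A → Set} (P? : Decidable P) pre y post → All P pre → ¬ P y →
          span P? (pre ++ y ∷ post) ≡ (pre , y ∷ post)
span-at P? [] y post [] ¬Py with P? y
... | yes Py = contradiction Py ¬Py
... | no _ = refl
span-at P? (x ∷ pre) y post (Px ∷ Ppre) ¬Py with P? x
... | yes _ = cong (map₁ (x ∷_)) (span-at P? pre y post Ppre ¬Py)
... | no ¬Px = contradiction Px ¬Px

take-++ˡ : ∀ {A : Set} {i} (xs ys : List A) → i ≤ length xs → take i (xs ++ ys) ≡ take i xs
take-++ˡ [] ys z≤n = refl
take-++ˡ (x ∷ xs) ys z≤n = refl
take-++ˡ (x ∷ xs) ys (s≤s i≤) = cong (x ∷_) (take-++ˡ xs ys i≤)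

drop-++ˡ : ∀ {A : Set} {i} (xs ys : List A) → i ≤ length xs → drop i (xs ++ ys) ≡ drop i xs ++ ys
drop-++ˡ [] ys z≤n = refl
drop-++ˡ (x ∷ xs) ys z≤n = refl
drop-++ˡ (x ∷ xs) ys (s≤s i≤) = drop-++ˡ xs ys i≤

take-++-∷ : ∀ {A : Set} (xs : List A) y ys j →
            take (suc (length xs ℕ.+ j)) (xs ++ y ∷ ys) ≡ xs ++ y ∷ take j ys
take-++-∷ [] y ys j = refl
take-++-∷ (x ∷ xs) y ys j = cong (x ∷_) (take-++-∷ xs y ys j)

drop-++-∷ : ∀ {A : Set} (xs : List A) y ys j →
            drop (suc (length xs ℕ.+ j)) (xs ++ y ∷ ys) ≡ drop j ys
drop-++-∷ [] y ys j = refl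
drop-++-∷ (x ∷ xs) y ys j = drop-++-∷ xs y ys j

rankIn : List ℕ → ℕ → ℕ
rankIn w x = length (filter (_≤? x) w)

rankIn-accept : ∀ {x y} w → y ≤ x → rankIn (y ∷ w) x ≡ suc (rankIn w x)
rankIn-accept {x} w y≤x = cong length (filter-accept (_≤? x) y≤x)

rankIn-reject : ∀ {x y} w → ¬ y ≤ x → rankIn (y ∷ w) x ≡ rankIn w x
rankIn-reject {x} w y≰x = cong length (filter-reject (_≤? x) y≰x)

rankIn-mono : ∀ w {x y} → x ≤ y → rankIn w x ≤ rankIn w y
rankIn-mono [] x≤y = z≤n
rankIn-mono (z ∷ w) {x} {y} x≤y with z ≤? x | z ≤? y
... | yes z≤x | yes z≤y rewrite rankIn-accept w z≤x | rankIn-accept w z≤y =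
  s≤s (rankIn-mono w x≤y)
... | yes z≤x | no z≰y = contradiction (≤-trans z≤x x≤y) z≰y
... | no z≰x | yes z≤y rewrite rankIn-reject w z≰x | rankIn-accept w z≤y =
  m≤n⇒m≤1+n (rankIn-mono w x≤y)
... | no z≰x | no z≰y rewrite rankIn-reject w z≰x | rankIn-reject w z≰y = rankIn-mono w x≤y

rankIn-strict : ∀ w {x y} → x < y → y ∈ w → rankIn w x < rankIn w y
rankIn-strict (y ∷ w) {x} x<y (here refl) with y ≤? x
... | yes y≤x = contradiction y≤x (<⇒≱ x<y)
... | no y≰x rewrite rankIn-reject w y≰x | rankIn-accept w (≤-refl {y}) =
  s≤s (rankIn-mono w (<⇒≤ x<y))
rankIn-strict (z ∷ w) {x} {y} x<y (there y∈w) with z ≤? x | z ≤? y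
... | yes z≤x | yes z≤y rewrite rankIn-accept w z≤x | rankIn-accept w z≤y =
  s≤s (rankIn-strict w x<y y∈w)
... | yes z≤x | no z≰y = contradiction (≤-trans z≤x (<⇒≤ x<y)) z≰y
... | no z≰x | yes z≤y rewrite rankIn-reject w z≰x | rankIn-accept w z≤y =
  m≤n⇒m≤1+n (rankIn-strict w x<y y∈w)
... | no z≰x | no z≰y rewrite rankIn-reject w z≰x | rankIn-reject w z≰y = rankIn-strict w x<y y∈w

rankIn-max : ∀ {m} w → All (_≤ m) w → rankIn w m ≡ length w
rankIn-max {m} w w≤m = cong length (filter-all (_≤? m) w≤m)

rankIn-<-length : ∀ {m x} w → m ∈ w → x < m → rankIn w x < length w
rankIn-<-length {x = x} w m∈w x<m = filter-notAll (_≤? x) w (Any.map (λ { refl → <⇒≱ x<m }) m∈w)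

OrderEmbeddingOn : (ℕ → ℕ) → List ℕ → Set
OrderEmbeddingOn f v = ∀ {x y} → x ∈ v → y ∈ v → (f x ≤ f y ⇔ x ≤ y)

rankIn-embedding : ∀ {u} w → u ⊆ w → OrderEmbeddingOn (rankIn w) u
rankIn-embedding w u⊆w {x} {y} x∈u _ = mk⇔ reflect (rankIn-mono w)
  where
  reflect : rankIn w x ≤ rankIn w y → x ≤ y
  reflect rx≤ry with x ≤? y
  ... | yes x≤y = x≤y
  ... | no x≰y = contradiction rx≤ry (<⇒≱ (rankIn-strict w (≰⇒> x≰y) (u⊆w x∈u)))

rankIn-map : ∀ f v {x} → (∀ {y} → y ∈ v → (f y ≤ f x ⇔ y ≤ x)) →
             rankIn (map f v) (f x) ≡ rankIn v x
rankIn-map f [] emb = refl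
rankIn-map f (y ∷ v) {x} emb with y ≤? x
... | yes y≤x
  rewrite rankIn-accept (map f v) (Equivalence.from (emb (here refl)) y≤x) | rankIn-accept v y≤x =
  cong suc (rankIn-map f v (emb ∘ there))
... | no y≰x
  rewrite rankIn-reject (map f v) (y≰x ∘ Equivalence.to (emb (here refl))) | rankIn-reject v y≰x =
  rankIn-map f v (emb ∘ there)

st-map : ∀ f v → OrderEmbeddingOn f v → st (map f v) ≡ st v
st-map f v emb = begin
  map (rankIn (map f v)) (map f v) ≡⟨ sym (map-∘ v) ⟩
  map (rankIn (map f v) ∘ f) v     ≡⟨ map-cong-local (All.tabulate λ x∈v → rankIn-map f v λ y∈v → emb y∈v x∈v) ⟩
  map (rankIn v) v                 ∎
  where open ≡-Reasoning

-- Shape w t: t is the decreasing tree of the word w, so that λ(st w) = t.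
data Shape : List ℕ → Tree → Set where
  empty : Shape [] leaf
  node : ∀ {wl m wr l r} → Shape wl l → Shape wr r → All (_< m) wl → All (_< m) wr →
         Shape (wl ++ m ∷ wr) (l ∨ r)

Shape-length : ∀ {w u} → Shape w u → length w ≡ size u
Shape-length empty = refl
Shape-length (node {wl} {m} {wr} sl sr _ _) =
  trans (length-++-∷ wl m wr) (cong₂ (λ a b → suc (a ℕ.+ b)) (Shape-length sl) (Shape-length sr))

Shape-map : ∀ {f} → f Preserves _<_ ⟶ _<_ → ∀ {w u} → Shape w u → Shape (map f w) u
Shape-map f-mono empty = empty
Shape-map {f} f-mono (node {wl} {m} {wr} sl sr wl<m wr<m) =
  subst (λ v → Shape v _) (sym (map-++ f wl (m ∷ wr)))
    (node (Shape-map f-mono sl) (Shape-map f-mono sr)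
          (map⁺ (All.map f-mono wl<m)) (map⁺ (All.map f-mono wr<m)))

λF-at-max : ∀ k pre n post → n ≡ length (pre ++ n ∷ post) → All (_< n) pre →
            λF (suc k) (pre ++ n ∷ post) ≡ λF k (st pre) ∨ λF k (st post)
λF-at-max k pre n post n≡len pre<n =
  trans (unfold pre) (cong (λ (p , q) → λF k (st p) ∨ λF k (st (drop 1 q))) split)
  where
  σ : List ℕ
  σ = pre ++ n ∷ post
  P? : (ys : List ℕ) → Decidable (λ x → ¬ x ≡ length ys)
  P? ys x = ¬? (x ℕ.≟ length ys)
  split : span (P? σ) σ ≡ (pre , n ∷ post)
  split = span-at (P? σ) pre n post (All.map (λ x<n x≡ → <⇒≢ x<n (trans x≡ (sym n≡len))) pre<n)
                  (λ n≢ → n≢ n≡len)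
  unfold : ∀ xs → let ys = xs ++ n ∷ post in
           λF (suc k) ys ≡
           λF k (st (proj₁ (span (P? ys) ys))) ∨ λF k (st (drop 1 (proj₂ (span (P? ys) ys))))
  unfold [] = refl
  unfold (_ ∷ _) = refl

λF-Shape : ∀ k {w u} → length w ≤ k → Shape w u → λF k (st w) ≡ u
λF-Shape zero _ empty = refl
λF-Shape (suc k) _ empty = refl
λF-Shape zero |w|≤0 (node {wl} {m} {wr} _ _ _ _) =
  contradiction (subst (_≤ 0) (length-++-∷ wl m wr) |w|≤0) λ ()
λF-Shape (suc k) |w|≤ (node {wl} {m} {wr} {l} {r} sl sr wl<m wr<m) = begin
  λF (suc k) (map g w)
    ≡⟨ cong (λF (suc k)) (map-++ g wl (m ∷ wr)) ⟩
  λF (suc k) (map g wl ++ g m ∷ map g wr)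
    ≡⟨ λF-at-max k (map g wl) (g m) (map g wr) g-max-length (map⁺ (All.map g-below wl<m)) ⟩
  λF k (st (map g wl)) ∨ λF k (st (map g wr))
    ≡⟨ cong₂ (λ p q → λF k p ∨ λF k q) (st-map g wl (rankIn-embedding w ∈-++⁺ˡ))
                                       (st-map g wr (rankIn-embedding w (∈-++⁺ʳ wl ∘ there))) ⟩
  λF k (st wl) ∨ λF k (st wr)
    ≡⟨ cong₂ _∨_ (λF-Shape k (≤-trans (m≤m+n _ _) |wl+wr|≤k) sl)
                 (λF-Shape k (≤-trans (m≤n+m _ _) |wl+wr|≤k) sr) ⟩
  l ∨ r ∎
  where
  open ≡-Reasoning
  w : List ℕ
  w = wl ++ m ∷ wr
  g : ℕ → ℕ
  g = rankIn w
  |wl+wr|≤k : length wl ℕ.+ length wr ≤ k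
  |wl+wr|≤k = s≤s⁻¹ (subst (_≤ suc k) (length-++-∷ wl m wr) |w|≤)
  g-max : g m ≡ length w
  g-max = rankIn-max w (++⁺ (All.map <⇒≤ wl<m) (≤-refl ∷ All.map <⇒≤ wr<m))
  g-max-length : g m ≡ length (map g wl ++ g m ∷ map g wr)
  g-max-length = trans g-max (trans (sym (length-map g w)) (cong length (map-++ g wl (m ∷ wr))))
  g-below : ∀ {x} → x < m → g x < g m
  g-below x<m = subst (g _ <_) (sym g-max) (rankIn-<-length w (∈-++⁺ʳ wl (here refl)) x<m)

λₚ-Shape : ∀ {w u} → Shape w u → λₚ (st w) ≡ u
λₚ-Shape {w} = λF-Shape (length (st w)) (subst (length w ≤_) (sym (length-map (rankIn w) w)) ≤-refl)

∨ₚ-below-max : ∀ {σ τ} → All (_≤ length σ) σ → All (_≤ length τ) τ →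
               let m = suc (length σ ℕ.+ length τ) in All (_< m) (map (ℕ._+ length τ) σ) × All (_< m) τ
∨ₚ-below-max {σ} {τ} σ≤ τ≤ =
  map⁺ (All.map (λ x≤ → s≤s (+-monoˡ-≤ (length τ) x≤)) σ≤) ,
  All.map (λ y≤ → s≤s (≤-trans y≤ (m≤n+m _ _))) τ≤

length-∨ₚ : ∀ σ τ → length (σ ∨ₚ τ) ≡ suc (length σ ℕ.+ length τ)
length-∨ₚ σ τ = trans (length-++-∷ (map _ σ) _ τ) (cong (λ n → suc (n ℕ.+ length τ)) (length-map _ σ))

∨ₚ-bounded : ∀ {σ τ} → All (_≤ length σ) σ → All (_≤ length τ) τ → All (_≤ length (σ ∨ₚ τ)) (σ ∨ₚ τ)
∨ₚ-bounded {σ} {τ} σ≤ τ≤ = let (σ< , τ<) = ∨ₚ-below-max σ≤ τ≤ in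
  subst (λ n → All (_≤ n) (σ ∨ₚ τ)) (sym (length-∨ₚ σ τ))
        (++⁺ (All.map <⇒≤ σ<) (≤-refl ∷ All.map <⇒≤ τ<))

Shape-∨ₚ : ∀ {σ τ l r} → Shape σ l → Shape τ r → All (_≤ length σ) σ → All (_≤ length τ) τ →
           Shape (σ ∨ₚ τ) (l ∨ r)
Shape-∨ₚ {τ = τ} sσ sτ σ≤ τ≤ = let (σ< , τ<) = ∨ₚ-below-max σ≤ τ≤ in
  node (Shape-map (+-monoˡ-< (length τ)) sσ) sτ σ< τ<

γ-bounded : ∀ t → All (_≤ length (γ t)) (γ t)
γ-bounded leaf = []
γ-bounded (l ∨ r) = ∨ₚ-bounded (γ-bounded l) (γ-bounded r)

Shape-γ : ∀ t → Shape (γ t) t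
Shape-γ leaf = empty
Shape-γ (l ∨ r) = Shape-∨ₚ (Shape-γ l) (Shape-γ r) (γ-bounded l) (γ-bounded r)

Shape-cut : ∀ {w u} → Shape w u → ∀ {i} → i ≤ size u →
            Shape (take i w) (proj₁ (cut u i)) × Shape (drop i w) (proj₂ (cut u i))
Shape-cut empty z≤n = empty , empty
Shape-cut (node {wl} {m} {wr} {l} {r} sl sr wl<m wr<m) {i} i≤ with compare≤ (size l) i
... | below i≤l rewrite cut-∨-below l r i≤l
                      | take-++ˡ wl (m ∷ wr) (subst (i ≤_) (sym (Shape-length sl)) i≤l)
                      | drop-++ˡ wl (m ∷ wr) (subst (i ≤_) (sym (Shape-length sl)) i≤l) =
  let (sˡ , sʳ) = Shape-cut sl i≤l in sˡ , node sʳ sr (drop⁺ i wl<m) wr<m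
... | above j
  rewrite cut-∨-above l r j | sym (Shape-length sl) | take-++-∷ wl m wr j | drop-++-∷ wl m wr j =
  let (sˡ , sʳ) = Shape-cut sr (+-cancelˡ-≤ (length wl) _ _ (s≤s⁻¹ i≤)) in
  node sl sˡ wl<m (take⁺ j wr<m) , sʳ

λₚ-cut : ∀ u {i} → i ≤ size u → (λₚ (st (take i (γ u))) , λₚ (st (drop i (γ u)))) ≡ cut u i
λₚ-cut u i≤ = let (sˡ , sʳ) = Shape-cut (Shape-γ u) i≤ in cong₂ _,_ (λₚ-Shape sˡ) (λₚ-Shape sʳ)

-- Finite sums and indicators

ind : ∀ {P : Set} → Dec P → ℚ
ind (yes _) = 1ℚ
ind (no _) = 0ℚ

ind-yes : ∀ {P : Set} (P? : Dec P) → P → ind P? ≡ 1ℚ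
ind-yes (yes _) p = refl
ind-yes (no ¬p) p = contradiction p ¬p

ind-no : ∀ {P : Set} (P? : Dec P) → ¬ P → ind P? ≡ 0ℚ
ind-no (yes p) ¬p = contradiction p ¬p
ind-no (no _) ¬p = refl

ind-⇔ : ∀ {P Q : Set} (P? : Dec P) (Q? : Dec Q) → P ⇔ Q → ind P? ≡ ind Q?
ind-⇔ P? (yes q) P⇔Q = ind-yes P? (Equivalence.from P⇔Q q)
ind-⇔ P? (no ¬q) P⇔Q = ind-no P? (¬q ∘ Equivalence.to P⇔Q)

ind-× : ∀ {P Q : Set} (P? : Dec P) (Q? : Dec Q) → ind (P? ×-dec Q?) ≡ ind P? * ind Q?
ind-× (yes p) (yes q) = refl
ind-× (yes p) (no ¬q) = refl
ind-× (no ¬p) Q? = sym (ℚ.*-zeroˡ (ind Q?))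

∑ : {A : Set} → List A → (A → ℚ) → ℚ
∑ xs f = sumℚ (map f xs)

syntax ∑ xs (λ x → e) = ∑[ x ∈ xs ] e

module _ {A : Set} where

  ∑-++ : ∀ (xs ys : List A) f → ∑ (xs ++ ys) f ≡ ∑ xs f + ∑ ys f
  ∑-++ [] ys f = sym (ℚ.+-identityˡ _)
  ∑-++ (x ∷ xs) ys f = trans (cong (f x +_) (∑-++ xs ys f)) (sym (ℚ.+-assoc (f x) _ _))

  ∑-cong : ∀ {f g : A → ℚ} xs → (∀ x → f x ≡ g x) → ∑ xs f ≡ ∑ xs g
  ∑-cong xs f≗g = cong sumℚ (map-cong f≗g xs)

  ∑-cong-∈ : ∀ {f g : A → ℚ} {xs} → All (λ x → f x ≡ g x) xs → ∑ xs f ≡ ∑ xs g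
  ∑-cong-∈ f≗g = cong sumℚ (map-cong-local f≗g)

  ∑-zero : ∀ {f : A → ℚ} xs → (∀ x → f x ≡ 0ℚ) → ∑ xs f ≡ 0ℚ
  ∑-zero [] f≗0 = refl
  ∑-zero (x ∷ xs) f≗0 = trans (cong₂ _+_ (f≗0 x) (∑-zero xs f≗0)) (ℚ.+-identityˡ 0ℚ)

  ∑-*ˡ : ∀ c (xs : List A) f → ∑[ x ∈ xs ] (c * f x) ≡ c * ∑ xs f
  ∑-*ˡ c [] f = sym (ℚ.*-zeroʳ c)
  ∑-*ˡ c (x ∷ xs) f = trans (cong (c * f x +_) (∑-*ˡ c xs f)) (sym (ℚ.*-distribˡ-+ c (f x) _))

  ∑-*ʳ : ∀ c (xs : List A) f → ∑[ x ∈ xs ] (f x * c) ≡ ∑ xs f * c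
  ∑-*ʳ c xs f = trans (∑-cong xs (λ x → ℚ.*-comm (f x) c)) (trans (∑-*ˡ c xs f) (ℚ.*-comm c _))

  ∑-+ : ∀ (xs : List A) f g → ∑[ x ∈ xs ] (f x + g x) ≡ ∑ xs f + ∑ xs g
  ∑-+ [] f g = sym (ℚ.+-identityˡ 0ℚ)
  ∑-+ (x ∷ xs) f g = trans (cong (f x + g x +_) (∑-+ xs f g)) (interchange (f x) (g x) _ _)
    where
    open +-*-Solver
    interchange : ∀ a b c d → (a + b) + (c + d) ≡ (a + c) + (b + d)
    interchange = solve 4 (λ a b c d → (a :+ b) :+ (c :+ d) := (a :+ c) :+ (b :+ d)) refl

  ∑-filter : ∀ {P : A → Set} (P? : Decidable P) xs f →
             ∑ (filter P? xs) f ≡ ∑[ x ∈ xs ] (ind (P? x) * f x)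
  ∑-filter P? [] f = refl
  ∑-filter P? (x ∷ xs) f with P? x
  ... | yes _ = cong₂ _+_ (sym (ℚ.*-identityˡ (f x))) (∑-filter P? xs f)
  ... | no _ = trans (∑-filter P? xs f) (sym (trans (cong (_+ _) (ℚ.*-zeroˡ (f x))) (ℚ.+-identityˡ _)))

module _ {A B : Set} where

  ∑-map : ∀ (g : A → B) xs f → ∑ (map g xs) f ≡ ∑ xs (f ∘ g)
  ∑-map g xs f = cong sumℚ (sym (map-∘ xs))

  ∑-concatMap : ∀ (g : A → List B) xs f → ∑ (concatMap g xs) f ≡ ∑[ x ∈ xs ] ∑ (g x) f
  ∑-concatMap g [] f = refl
  ∑-concatMap g (x ∷ xs) f =
    trans (∑-++ (g x) (concatMap g xs) f) (cong (∑ (g x) f +_) (∑-concatMap g xs f))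

  ∑-swap : ∀ xs ys (f : A → B → ℚ) → ∑[ x ∈ xs ] ∑[ y ∈ ys ] f x y ≡ ∑[ y ∈ ys ] ∑[ x ∈ xs ] f x y
  ∑-swap [] ys f = sym (∑-zero ys (λ _ → refl))
  ∑-swap (x ∷ xs) ys f = trans (cong (∑ ys (f x) +_) (∑-swap xs ys f)) (sym (∑-+ ys (f x) _))

ind-<-suc : ∀ c m (f : ℕ → ℚ) → ind (c <? m) * f c + ind (c ℕ.≟ m) * f m ≡ ind (c <? suc m) * f c
ind-<-suc c m f with <-cmp c m
... | tri< c<m _ _
  rewrite ind-yes (c <? m) c<m | ind-no (c ℕ.≟ m) (<⇒≢ c<m) | ind-yes (c <? suc m) (m≤n⇒m≤1+n c<m) =
  trans (cong (1ℚ * f c +_) (ℚ.*-zeroˡ (f m))) (ℚ.+-identityʳ _)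
... | tri≈ _ refl _
  rewrite ind-no (c <? c) (n≮n c) | ind-yes (c ℕ.≟ c) refl | ind-yes (c <? suc c) (n<1+n c) =
  trans (cong (_+ 1ℚ * f c) (ℚ.*-zeroˡ (f c))) (ℚ.+-identityˡ _)
... | tri> _ _ m<c
  rewrite ind-no (c <? m) (<⇒≱ m<c ∘ <⇒≤) | ind-no (c ℕ.≟ m) (>⇒≢ m<c)
        | ind-no (c <? suc m) (<⇒≱ m<c ∘ s≤s⁻¹) =
  trans (cong (0ℚ * f c +_) (ℚ.*-zeroˡ (f m))) (ℚ.+-identityʳ _)

∑-upTo-ind : ∀ c m (f : ℕ → ℚ) → ∑[ i ∈ upTo m ] (ind (c ℕ.≟ i) * f i) ≡ ind (c <? m) * f c
∑-upTo-ind c zero f = sym (trans (cong (_* f c) (ind-no (c <? 0) λ ())) (ℚ.*-zeroˡ (f c)))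
∑-upTo-ind c (suc m) f = begin
  ∑ (upTo (suc m)) g                        ≡⟨ cong (λ is → ∑ is g) (sym (applyUpTo-∷ʳ id m)) ⟩
  ∑ (upTo m ∷ʳ m) g                         ≡⟨ ∑-++ (upTo m) [ m ] g ⟩
  ∑ (upTo m) g + (g m + 0ℚ)                 ≡⟨ cong₂ _+_ (∑-upTo-ind c m f) (ℚ.+-identityʳ (g m)) ⟩
  ind (c <? m) * f c + ind (c ℕ.≟ m) * f m  ≡⟨ ind-<-suc c m f ⟩
  ind (c <? suc m) * f c                    ∎
  where
  open ≡-Reasoning
  g : ℕ → ℚ
  g i = ind (c ℕ.≟ i) * f i

δ≡ind : ∀ s t → δ s t ≡ ind (s ≟T t)
δ≡ind s t with s ≟T t
... | yes _ = refl
... | no _ = refl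

δ-refl : ∀ t → δ t t ≡ 1ℚ
δ-refl t = trans (δ≡ind t t) (ind-yes (t ≟T t) refl)

δ-≢ : ∀ {s t} → ¬ s ≡ t → δ s t ≡ 0ℚ
δ-≢ {s} {t} s≢t = trans (δ≡ind s t) (ind-no (s ≟T t) s≢t)

δ-∨ : ∀ l r l' r' → δ (l ∨ r) (l' ∨ r') ≡ δ l l' * δ r r'
δ-∨ l r l' r' = begin
  δ (l ∨ r) (l' ∨ r')                 ≡⟨ δ≡ind (l ∨ r) (l' ∨ r') ⟩
  ind ((l ∨ r) ≟T (l' ∨ r'))          ≡⟨ ind-⇔ ((l ∨ r) ≟T (l' ∨ r')) (l ≟T l' ×-dec r ≟T r') ∨-≡⇔ ⟩
  ind (l ≟T l' ×-dec r ≟T r')         ≡⟨ ind-× (l ≟T l') (r ≟T r') ⟩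
  ind (l ≟T l') * ind (r ≟T r')       ≡⟨ sym (cong₂ _*_ (δ≡ind l l') (δ≡ind r r')) ⟩
  δ l l' * δ r r'                     ∎
  where
  open ≡-Reasoning
  ∨-≡⇔ : (l ∨ r) ≡ (l' ∨ r') ⇔ (l ≡ l' × r ≡ r')
  ∨-≡⇔ = mk⇔ (λ e → ∨-injˡ e , ∨-injʳ e) (λ (p , q) → cong₂ _∨_ p q)

δ-select : ∀ s t a b (F : Tree → Tree → ℚ) → F s t * (δ s a * δ t b) ≡ δ a s * (δ b t * F a b)
δ-select s t a b F = select (s ≟T a) (t ≟T b)
  where
  select : Dec (s ≡ a) → Dec (t ≡ b) → F s t * (δ s a * δ t b) ≡ δ a s * (δ b t * F a b)
  select (yes refl) (yes refl) rewrite δ-refl s | δ-refl t =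
    trans (ℚ.*-identityʳ (F s t)) (sym (trans (ℚ.*-identityˡ (1ℚ * F s t)) (ℚ.*-identityˡ (F s t))))
  select (no s≢a) _ rewrite δ-≢ s≢a | δ-≢ (s≢a ∘ sym) =
    trans (cong (F s t *_) (ℚ.*-zeroˡ (δ t b)))
          (trans (ℚ.*-zeroʳ (F s t)) (sym (ℚ.*-zeroˡ (δ b t * F a b))))
  select (yes _) (no t≢b) rewrite δ-≢ t≢b | δ-≢ (t≢b ∘ sym) =
    trans (cong (F s t *_) (ℚ.*-zeroʳ (δ s a))) (trans (ℚ.*-zeroʳ (F s t))
      (sym (trans (cong (δ a s *_) (ℚ.*-zeroˡ (F a b))) (ℚ.*-zeroʳ (δ a s)))))

-- Enumeration of trees

upTo-bounded : ∀ m → All (_< m) (upTo m)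
upTo-bounded m = applyUpTo⁺₁ id m id

<suc×≡∸⇔+≡ : ∀ {a b n} → (a < suc n × b ≡ n ∸ a) ⇔ a ℕ.+ b ≡ n
<suc×≡∸⇔+≡ {a} {b} {n} = mk⇔
  (λ (a<sn , b≡) → trans (cong (a ℕ.+_) b≡) (m+[n∸m]≡n (s≤s⁻¹ a<sn)))
  (λ a+b≡n → s≤s (subst (a ≤_) a+b≡n (m≤m+n a b)) , trans (sym (m+n∸m≡n a b)) (cong (_∸ a) a+b≡n))

-- T lists every tree of size n exactly once, and no other tree.
Enumerates : List Tree → ℕ → Set
Enumerates T n = ∀ x (f : Tree → ℚ) → ∑[ v ∈ T ] (δ x v * f v) ≡ ind (size x ℕ.≟ n) * f x

∑-splits-δ : ∀ (T : ℕ → List Tree) n → (∀ {i} → i ≤ n → Enumerates (T i) i) →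
             ∀ a b (g : Tree → Tree → ℚ) →
             ∑[ i ∈ upTo (suc n) ] ∑[ l ∈ T i ] ∑[ r ∈ T (n ∸ i) ] (δ a l * (δ b r * g l r))
               ≡ ind (size a ℕ.+ size b ℕ.≟ n) * g a b
∑-splits-δ T n enum a b g = begin
  ∑[ i ∈ upTo (suc n) ] ∑[ l ∈ T i ] ∑[ r ∈ T (n ∸ i) ] (δ a l * (δ b r * g l r))
    ≡⟨ ∑-cong (upTo (suc n)) (λ i → ∑-cong (T i) λ l →
         trans (∑-*ˡ (δ a l) (T (n ∸ i)) _) (cong (δ a l *_) (enum (m∸n≤m n i) b (g l)))) ⟩
  ∑[ i ∈ upTo (suc n) ] ∑[ l ∈ T i ] (δ a l * (ind (size b ℕ.≟ n ∸ i) * g l b))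
    ≡⟨ ∑-cong-∈ (All.map (λ {i} i<sn → enum (s≤s⁻¹ i<sn) a (λ l → ind (size b ℕ.≟ n ∸ i) * g l b))
                         (upTo-bounded (suc n))) ⟩
  ∑[ i ∈ upTo (suc n) ] (ind (size a ℕ.≟ i) * (ind (size b ℕ.≟ n ∸ i) * g a b))
    ≡⟨ ∑-upTo-ind (size a) (suc n) _ ⟩
  ind (size a <? suc n) * (ind (size b ℕ.≟ n ∸ size a) * g a b)
    ≡⟨ sym (ℚ.*-assoc (ind (size a <? suc n)) (ind (size b ℕ.≟ n ∸ size a)) (g a b)) ⟩
  ind (size a <? suc n) * ind (size b ℕ.≟ n ∸ size a) * g a b
    ≡⟨ cong (_* g a b) (sym (ind-× (size a <? suc n) (size b ℕ.≟ n ∸ size a))) ⟩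
  ind (size a <? suc n ×-dec size b ℕ.≟ n ∸ size a) * g a b
    ≡⟨ cong (_* g a b) (ind-⇔ (size a <? suc n ×-dec size b ℕ.≟ n ∸ size a) (size a ℕ.+ size b ℕ.≟ n)
                              <suc×≡∸⇔+≡) ⟩
  ind (size a ℕ.+ size b ℕ.≟ n) * g a b ∎
  where open ≡-Reasoning

∑-treesF-suc : ∀ k n (h : Tree → ℚ) →
               ∑ (treesF (suc k) (suc n)) h ≡
               ∑[ i ∈ upTo (suc n) ] ∑[ l ∈ treesF k i ] ∑[ r ∈ treesF k (n ∸ i) ] h (l ∨ r)
∑-treesF-suc k n h =
  trans (∑-concatMap (λ i → concatMap (row i) (treesF k i)) (upTo (suc n)) h)
        (∑-cong (upTo (suc n)) λ i → trans (∑-concatMap (row i) (treesF k i) h)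
                                           (∑-cong (treesF k i) λ l → ∑-map (l ∨_) (treesF k (n ∸ i)) h))
  where
  row : ℕ → Tree → List Tree
  row i l = map (l ∨_) (treesF k (n ∸ i))

treesF-enumerates : ∀ k n → n ≤ k → Enumerates (treesF k n) n
treesF-enumerates k zero _ leaf f =
  trans (ℚ.+-identityʳ _) (cong (_* f leaf) (sym (ind-yes (0 ℕ.≟ 0) refl)))
treesF-enumerates k zero _ (l ∨ r) f =
  trans (ℚ.+-identityʳ _) (trans (ℚ.*-zeroˡ (f leaf))
    (sym (trans (cong (_* f (l ∨ r)) (ind-no (size (l ∨ r) ℕ.≟ 0) λ ())) (ℚ.*-zeroˡ (f (l ∨ r))))))
treesF-enumerates (suc k) (suc n) _ leaf f =
  trans (∑-treesF-suc k n _)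
    (trans (∑-zero (upTo (suc n)) λ i → ∑-zero (treesF k i) λ l → ∑-zero (treesF k (n ∸ i)) λ r →
              ℚ.*-zeroˡ (f (l ∨ r)))
           (sym (trans (cong (_* f leaf) (ind-no (0 ℕ.≟ suc n) λ ())) (ℚ.*-zeroˡ (f leaf)))))
treesF-enumerates (suc k) (suc n) (s≤s n≤k) (xl ∨ xr) f = begin
  ∑[ v ∈ treesF (suc k) (suc n) ] (δ (xl ∨ xr) v * f v)
    ≡⟨ ∑-treesF-suc k n _ ⟩
  ∑[ i ∈ upTo (suc n) ] ∑[ l ∈ treesF k i ] ∑[ r ∈ treesF k (n ∸ i) ] (δ (xl ∨ xr) (l ∨ r) * f (l ∨ r))
    ≡⟨ ∑-cong (upTo (suc n)) (λ i → ∑-cong (treesF k i) λ l → ∑-cong (treesF k (n ∸ i)) λ r →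
         trans (cong (_* f (l ∨ r)) (δ-∨ xl xr l r)) (ℚ.*-assoc (δ xl l) (δ xr r) (f (l ∨ r)))) ⟩
  ∑[ i ∈ upTo (suc n) ] ∑[ l ∈ treesF k i ] ∑[ r ∈ treesF k (n ∸ i) ] (δ xl l * (δ xr r * f (l ∨ r)))
    ≡⟨ ∑-splits-δ (treesF k) n (λ i≤n → treesF-enumerates k _ (≤-trans i≤n n≤k)) xl xr (λ l r → f (l ∨ r)) ⟩
  ind (size xl ℕ.+ size xr ℕ.≟ n) * f (xl ∨ xr)
    ≡⟨ cong (_* f (xl ∨ xr))
            (ind-⇔ (size xl ℕ.+ size xr ℕ.≟ n) (size (xl ∨ xr) ℕ.≟ suc n) (mk⇔ (cong suc) suc-injective)) ⟩
  ind (size (xl ∨ xr) ℕ.≟ suc n) * f (xl ∨ xr) ∎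
  where open ≡-Reasoning

𝒴-enumerates : ∀ n → Enumerates (𝒴 n) n
𝒴-enumerates n = treesF-enumerates (suc n) n (n≤1+n n)

∑-𝒴-δ : ∀ {n} x (f : Tree → ℚ) → size x ≡ n → ∑[ v ∈ 𝒴 n ] (δ x v * f v) ≡ f x
∑-𝒴-δ {n} x f x∈𝒴n =
  trans (𝒴-enumerates n x f) (trans (cong (_* f x) (ind-yes (size x ℕ.≟ n) x∈𝒴n)) (ℚ.*-identityˡ (f x)))

-- Pairing tensors with a kernel

weight : (Tree → Tree → ℚ) → Tree → Tree → ℚ × Tree × Tree → ℚ
weight κ a b (c , s , t) = c * κ s a * κ t b

-- coeff x a b is pairing δ x a b by definition.
pairing : (Tree → Tree → ℚ) → Tensor → Tree → Tree → ℚ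
pairing κ x a b = ∑ x (weight κ a b)

pairing-++ : ∀ κ x y a b → pairing κ (x ++ y) a b ≡ pairing κ x a b + pairing κ y a b
pairing-++ κ x y a b = ∑-++ x y _

pairing-scale : ∀ κ c x a b → pairing κ (scale c x) a b ≡ c * pairing κ x a b
pairing-scale κ c x a b = trans (∑-map _ x _) (trans (∑-cong x assoc) (∑-*ˡ c x _))
  where
  assoc : ∀ ((d , s , t) : ℚ × Tree × Tree) → c * d * κ s a * κ t b ≡ c * (d * κ s a * κ t b)
  assoc (d , s , t) = trans (cong (_* κ t b) (ℚ.*-assoc c d (κ s a))) (ℚ.*-assoc c (d * κ s a) (κ t b))

-- Zeta and Möbius functions

module Zeta (ζ : Tree → Tree → ℚ) (isZ : IsZeta ζ) where

  -- ≤T is not known to be decidable, so ζ a b ≢ 0 only yields ¬ ¬ a ≤T b; this suffices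
  -- because it is only used to prove equations between rationals, which are decidable.
  data ZetaView (a b : Tree) : Set where
    related : ζ a b ≡ 1ℚ → ¬ ¬ a ≤T b → ZetaView a b
    unrelated : ζ a b ≡ 0ℚ → ¬ a ≤T b → ZetaView a b

  zeta-view : ∀ a b → ZetaView a b
  zeta-view a b with ζ a b ℚ.≟ 0ℚ
  ... | yes ζ≡0 = unrelated ζ≡0 (λ a≤b → ℚ.1≢0 (trans (sym (proj₁ (isZ a b) a≤b)) ζ≡0))
  ... | no ζ≢0 =
    related (decidable-stable (ζ a b ℚ.≟ 1ℚ) (λ ζ≢1 → ¬¬a≤b (ζ≢1 ∘ proj₁ (isZ a b)))) ¬¬a≤b
    where
    ¬¬a≤b : ¬ ¬ a ≤T b
    ¬¬a≤b = ζ≢0 ∘ proj₂ (isZ a b)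

  ζ-refl : ∀ a → ζ a a ≡ 1ℚ
  ζ-refl a = proj₁ (isZ a a) ε

  ζ-size : ∀ {a b} → size a ≢ size b → ζ a b ≡ 0ℚ
  ζ-size {a} {b} ≢size with zeta-view a b
  ... | related _ ¬¬a≤b = contradiction (≢size ∘ size-≤T) ¬¬a≤b
  ... | unrelated ζ≡0 _ = ζ≡0

  ζ-sized : ∀ a b → ind (size a ℕ.≟ size b) * ζ a b ≡ ζ a b
  ζ-sized a b with size a ℕ.≟ size b
  ... | yes _ = ℚ.*-identityˡ (ζ a b)
  ... | no ≢size = trans (ℚ.*-zeroˡ (ζ a b)) (sym (ζ-size ≢size))

  ζ-× : ∀ {a b c d e f} → a ≤T b ⇔ (c ≤T d × e ≤T f) → ζ c d * ζ e f ≡ ζ a b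
  ζ-× {a} {b} {c} {d} {e} {f} a≤b⇔ with zeta-view a b | zeta-view c d | zeta-view e f
  ... | related ab _ | related cd _ | related ef _ =
    trans (cong₂ _*_ cd ef) (trans (ℚ.*-identityˡ 1ℚ) (sym ab))
  ... | related _ ¬¬a≤b | unrelated _ c≰d | _ =
    contradiction (c≰d ∘ proj₁ ∘ Equivalence.to a≤b⇔) ¬¬a≤b
  ... | related _ ¬¬a≤b | related _ _ | unrelated _ e≰f =
    contradiction (e≰f ∘ proj₂ ∘ Equivalence.to a≤b⇔) ¬¬a≤b
  ... | unrelated ab _ | unrelated cd _ | _ =
    trans (cong (_* ζ e f) cd) (trans (ℚ.*-zeroˡ (ζ e f)) (sym ab))
  ... | unrelated ab _ | related _ _ | unrelated ef _ =
    trans (cong (ζ c d *_) ef) (trans (ℚ.*-zeroʳ (ζ c d)) (sym ab))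
  ... | unrelated _ a≰b | related _ ¬¬c≤d | related _ ¬¬e≤f =
    contradiction (λ c≤d → ¬¬e≤f (λ e≤f → a≰b (Equivalence.from a≤b⇔ (c≤d , e≤f)))) ¬¬c≤d

  ζ-cut : ∀ u a b → ζ (proj₁ (cut u (size a))) a * ζ (proj₂ (cut u (size a))) b ≡ ζ u (a ＼ b)
  ζ-cut u a b = ζ-× (cut-galois u a b)

  ∑-𝒴-δ-ζ : ∀ x a k → ∑[ v ∈ 𝒴 (size a) ] (δ x v * (k * ζ v a)) ≡ k * ζ x a
  ∑-𝒴-δ-ζ x a k = begin
    ∑[ v ∈ 𝒴 (size a) ] (δ x v * (k * ζ v a)) ≡⟨ 𝒴-enumerates (size a) x (λ v → k * ζ v a) ⟩
    ind (size x ℕ.≟ size a) * (k * ζ x a)     ≡⟨ x∙yz≈y∙xz (ind (size x ℕ.≟ size a)) k (ζ x a) ⟩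
    k * (ind (size x ℕ.≟ size a) * ζ x a)     ≡⟨ cong (k *_) (ζ-sized x a) ⟩
    k * ζ x a                                 ∎
    where
    open ≡-Reasoning
    open +-*-Solver
    x∙yz≈y∙xz : ∀ x y z → x * (y * z) ≡ y * (x * z)
    x∙yz≈y∙xz = solve 3 (λ x y z → x :* (y :* z) := y :* (x :* z)) refl

  pairing-ΔF : ∀ u a b → pairing ζ (ΔF u) a b ≡ ζ u (a ＼ b)
  pairing-ΔF u a b = begin
    pairing ζ (ΔF u) a b
      ≡⟨ ∑-map (λ i → (1ℚ , λₚ (st (take i (γ u))) , λₚ (st (drop i (γ u))))) (upTo (suc (size u)))
               (weight ζ a b) ⟩
    ∑[ i ∈ upTo (suc (size u)) ] (1ℚ * ζ (λₚ (st (take i (γ u)))) a * ζ (λₚ (st (drop i (γ u)))) b)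
      ≡⟨ ∑-cong-∈ (All.map (λ i<sn → at-cut (s≤s⁻¹ i<sn)) (upTo-bounded (suc (size u)))) ⟩
    ∑[ i ∈ upTo (suc (size u)) ] (ind (size a ℕ.≟ i) * ζ² i)
      ≡⟨ ∑-upTo-ind (size a) (suc (size u)) ζ² ⟩
    ind (size a <? suc (size u)) * ζ² (size a)
      ≡⟨ cong (ind (size a <? suc (size u)) *_) (ζ-cut u a b) ⟩
    ind (size a <? suc (size u)) * ζ u (a ＼ b)
      ≡⟨ fits ⟩
    ζ u (a ＼ b) ∎
    where
    open ≡-Reasoning
    ζ² : ℕ → ℚ
    ζ² i = ζ (proj₁ (cut u i)) a * ζ (proj₂ (cut u i)) b
    only-size-a : ∀ i → i ≤ size u → ζ² i ≡ ind (size a ℕ.≟ i) * ζ² i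
    only-size-a i i≤ with size a ℕ.≟ i
    ... | yes _ = sym (ℚ.*-identityˡ (ζ² i))
    ... | no a≢i =
      trans (cong (_* ζ (proj₂ (cut u i)) b) (ζ-size (a≢i ∘ sym ∘ trans (sym (size-cut u i≤)))))
            (trans (ℚ.*-zeroˡ (ζ (proj₂ (cut u i)) b)) (sym (ℚ.*-zeroˡ (ζ² i))))
    at-cut : ∀ {i} → i ≤ size u →
             1ℚ * ζ (λₚ (st (take i (γ u)))) a * ζ (λₚ (st (drop i (γ u)))) b ≡ ind (size a ℕ.≟ i) * ζ² i
    at-cut {i} i≤ =
      trans (cong₂ (λ l r → 1ℚ * ζ l a * ζ r b) (cong proj₁ (λₚ-cut u i≤)) (cong proj₂ (λₚ-cut u i≤)))
            (trans (cong (_* ζ (proj₂ (cut u i)) b) (ℚ.*-identityˡ (ζ (proj₁ (cut u i)) a))) (only-size-a i i≤))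
    fits : ind (size a <? suc (size u)) * ζ u (a ＼ b) ≡ ζ u (a ＼ b)
    fits with size a <? suc (size u)
    ... | yes _ = ℚ.*-identityˡ (ζ u (a ＼ b))
    ... | no a≮ = trans (ℚ.*-zeroˡ (ζ u (a ＼ b))) (sym (ζ-size λ u≡ →
                    a≮ (s≤s (subst (size a ≤_) (sym (trans u≡ (size-＼ a b))) (m≤m+n (size a) (size b))))))

  pairing-expand : ∀ x a b →
    pairing ζ x a b ≡ ∑[ s ∈ 𝒴 (size a) ] ∑[ t ∈ 𝒴 (size b) ] (coeff x s t * (ζ s a * ζ t b))
  pairing-expand x a b = begin
    ∑ x (weight ζ a b)
      ≡⟨ ∑-cong x expand-entry ⟩
    ∑[ e ∈ x ] ∑[ s ∈ 𝒴 (size a) ] ∑[ t ∈ 𝒴 (size b) ] (weight δ s t e * (ζ s a * ζ t b))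
      ≡⟨ ∑-swap x (𝒴 (size a)) _ ⟩
    ∑[ s ∈ 𝒴 (size a) ] ∑[ e ∈ x ] ∑[ t ∈ 𝒴 (size b) ] (weight δ s t e * (ζ s a * ζ t b))
      ≡⟨ ∑-cong (𝒴 (size a)) (λ s → ∑-swap x (𝒴 (size b)) _) ⟩
    ∑[ s ∈ 𝒴 (size a) ] ∑[ t ∈ 𝒴 (size b) ] ∑[ e ∈ x ] (weight δ s t e * (ζ s a * ζ t b))
      ≡⟨ ∑-cong (𝒴 (size a)) (λ s → ∑-cong (𝒴 (size b)) λ t → ∑-*ʳ (ζ s a * ζ t b) x (weight δ s t)) ⟩
    ∑[ s ∈ 𝒴 (size a) ] ∑[ t ∈ 𝒴 (size b) ] (coeff x s t * (ζ s a * ζ t b)) ∎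
    where
    open ≡-Reasoning
    open +-*-Solver
    expand-entry : ∀ e →
      weight ζ a b e ≡ ∑[ s ∈ 𝒴 (size a) ] ∑[ t ∈ 𝒴 (size b) ] (weight δ s t e * (ζ s a * ζ t b))
    expand-entry (c , s' , t') = sym (begin
      ∑[ s ∈ 𝒴 (size a) ] ∑[ t ∈ 𝒴 (size b) ] (c * δ s' s * δ t' t * (ζ s a * ζ t b))
        ≡⟨ ∑-cong (𝒴 (size a)) (λ s → ∑-cong (𝒴 (size b)) λ t → regroup c (δ s' s) (δ t' t) (ζ s a) (ζ t b)) ⟩
      ∑[ s ∈ 𝒴 (size a) ] ∑[ t ∈ 𝒴 (size b) ] (δ s' s * (δ t' t * (c * ζ s a * ζ t b)))
        ≡⟨ ∑-cong (𝒴 (size a)) (λ s → trans (∑-*ˡ (δ s' s) (𝒴 (size b)) _)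
                                            (cong (δ s' s *_) (∑-𝒴-δ-ζ t' b (c * ζ s a)))) ⟩
      ∑[ s ∈ 𝒴 (size a) ] (δ s' s * (c * ζ s a * ζ t' b))
        ≡⟨ ∑-cong (𝒴 (size a)) (λ s → cong (δ s' s *_) (swap c (ζ s a) (ζ t' b))) ⟩
      ∑[ s ∈ 𝒴 (size a) ] (δ s' s * (c * ζ t' b * ζ s a))
        ≡⟨ ∑-𝒴-δ-ζ s' a (c * ζ t' b) ⟩
      c * ζ t' b * ζ s' a
        ≡⟨ swap c (ζ t' b) (ζ s' a) ⟩
      c * ζ s' a * ζ t' b ∎)
      where
      regroup : ∀ c p q y z → c * p * q * (y * z) ≡ p * (q * (c * y * z))
      regroup = solve 5 (λ c p q y z → c :* p :* q :* (y :* z) := p :* (q :* (c :* y :* z))) refl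
      swap : ∀ c y z → c * y * z ≡ c * z * y
      swap = solve 3 (λ c y z → c :* y :* z := c :* z :* y) refl

  -- ζ ⊗ ζ is unitriangular: pairing ζ x a b is coeff x a b plus the coefficients of x at pairs
  -- (s , t) < (a , b), which have smaller total rank and vanish by induction.
  pairing≡0⇒coeff≡0 : ∀ x → (∀ a b → pairing ζ x a b ≡ 0ℚ) → ∀ a b → coeff x a b ≡ 0ℚ
  pairing≡0⇒coeff≡0 x pairing≡0 a b = go a b (<-wellFounded (rank a ℕ.+ rank b))
    where
    go : ∀ a b → Acc _<_ (rank a ℕ.+ rank b) → coeff x a b ≡ 0ℚ
    go a b (acc smaller) = begin
      coeff x a b
        ≡⟨ sym (∑-𝒴-δ a _ refl) ⟩
      ∑[ s ∈ 𝒴 (size a) ] (δ a s * coeff x a b)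
        ≡⟨ ∑-cong (𝒴 (size a)) (λ s → cong (δ a s *_) (sym (∑-𝒴-δ b _ refl))) ⟩
      ∑[ s ∈ 𝒴 (size a) ] (δ a s * ∑[ t ∈ 𝒴 (size b) ] (δ b t * coeff x a b))
        ≡⟨ ∑-cong (𝒴 (size a)) (λ s → sym (∑-*ˡ (δ a s) (𝒴 (size b)) _)) ⟩
      ∑[ s ∈ 𝒴 (size a) ] ∑[ t ∈ 𝒴 (size b) ] (δ a s * (δ b t * coeff x a b))
        ≡⟨ ∑-cong (𝒴 (size a)) (λ s → ∑-cong (𝒴 (size b)) (λ t → triangular s t)) ⟩
      ∑[ s ∈ 𝒴 (size a) ] ∑[ t ∈ 𝒴 (size b) ] (coeff x s t * (ζ s a * ζ t b))
        ≡⟨ sym (pairing-expand x a b) ⟩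
      pairing ζ x a b
        ≡⟨ pairing≡0 a b ⟩
      0ℚ ∎
      where
      open ≡-Reasoning
      vanishes-below : ∀ s t → ¬ (s ≡ a × t ≡ b) → coeff x s t * (ζ s a * ζ t b) ≡ 0ℚ
      vanishes-below s t ≢ with zeta-view s a | zeta-view t b
      ... | unrelated sa _ | _ =
        trans (cong (λ z → coeff x s t * (z * ζ t b)) sa)
              (trans (cong (coeff x s t *_) (ℚ.*-zeroˡ (ζ t b))) (ℚ.*-zeroʳ (coeff x s t)))
      ... | related _ _ | unrelated tb _ =
        trans (cong (λ z → coeff x s t * (ζ s a * z)) tb)
              (trans (cong (coeff x s t *_) (ℚ.*-zeroʳ (ζ s a))) (ℚ.*-zeroʳ (coeff x s t)))
      ... | related _ ¬¬s≤a | related _ ¬¬t≤b =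
        decidable-stable (coeff x s t * (ζ s a * ζ t b) ℚ.≟ 0ℚ) λ ≢0 → ¬¬s≤a λ s≤a → ¬¬t≤b λ t≤b →
          ≢0 (trans (cong (_* (ζ s a * ζ t b)) (go s t (smaller (rank-+-< s≤a t≤b ≢))))
                    (ℚ.*-zeroˡ (ζ s a * ζ t b)))
      triangular : ∀ s t → δ a s * (δ b t * coeff x a b) ≡ coeff x s t * (ζ s a * ζ t b)
      triangular s t with s ≟T a | t ≟T b
      ... | yes refl | yes refl rewrite δ-refl s | δ-refl t | ζ-refl s | ζ-refl t =
        trans (ℚ.*-identityˡ (1ℚ * coeff x s t))
              (trans (ℚ.*-identityˡ (coeff x s t)) (sym (ℚ.*-identityʳ (coeff x s t))))
      ... | no s≢a | _ = trans (cong (_* (δ b t * coeff x a b)) (δ-≢ (s≢a ∘ sym)))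
                           (trans (ℚ.*-zeroˡ (δ b t * coeff x a b)) (sym (vanishes-below s t (s≢a ∘ proj₁))))
      ... | yes _ | no t≢b = trans (cong (λ z → δ a s * (z * coeff x a b)) (δ-≢ (t≢b ∘ sym)))
                               (trans (cong (δ a s *_) (ℚ.*-zeroˡ (coeff x a b)))
                                 (trans (ℚ.*-zeroʳ (δ a s)) (sym (vanishes-below s t (t≢b ∘ proj₂)))))

  pairing-injective : ∀ x y → (∀ a b → pairing ζ x a b ≡ pairing ζ y a b) →
                      ∀ a b → coeff x a b ≡ coeff y a b
  pairing-injective x y same a b = begin
    coeff x a b                                    ≡⟨ sym (add-back (coeff x a b) (coeff y a b)) ⟩
    coeff x a b + - 1ℚ * coeff y a b + coeff y a b ≡⟨ cong (_+ coeff y a b) coeff-difference≡0 ⟩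
    0ℚ + coeff y a b                               ≡⟨ ℚ.+-identityˡ (coeff y a b) ⟩
    coeff y a b                                    ∎
    where
    open ≡-Reasoning
    open +-*-Solver
    difference : Tensor
    difference = x ++ scale (- 1ℚ) y
    pairing-difference : ∀ κ a b →
                         pairing κ difference a b ≡ pairing κ x a b + - 1ℚ * pairing κ y a b
    pairing-difference κ a b =
      trans (pairing-++ κ x _ a b) (cong (pairing κ x a b +_) (pairing-scale κ (- 1ℚ) y a b))
    add-back : ∀ p q → p + - 1ℚ * q + q ≡ p
    add-back = solve 2 (λ p q → p :+ con (- 1ℚ) :* q :+ q := p) refl
    cancel : ∀ {p q} → p ≡ q → p + - 1ℚ * q ≡ 0ℚ
    cancel {q = q} refl = solve 1 (λ q → q :+ con (- 1ℚ) :* q := con 0ℚ) refl q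
    coeff-difference≡0 : coeff x a b + - 1ℚ * coeff y a b ≡ 0ℚ
    coeff-difference≡0 = trans (sym (pairing-difference δ a b))
      (pairing≡0⇒coeff≡0 difference (λ a' b' → trans (pairing-difference ζ a' b') (cancel (same a' b')))
                         a b)

module Möbius (ζ μ : Tree → Tree → ℚ) (isZ : IsZeta ζ) (isM : IsMöbius ζ μ) where

  open Zeta ζ isZ

  μ-triangular : ∀ {r u} → size u ≡ size r → ¬ r ≤T u → μ r u ≡ 0ℚ
  μ-triangular {r} {u} = go u (<-wellFounded (rank u))
    where
    go : ∀ u → Acc _<_ (rank u) → size u ≡ size r → ¬ r ≤T u → μ r u ≡ 0ℚ
    go u (acc smaller) u~r r≰u = begin
      μ r u                                      ≡⟨ sym (∑-𝒴-δ u (λ _ → μ r u) u~r) ⟩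
      ∑[ v ∈ 𝒴 (size r) ] (δ u v * μ r u)         ≡⟨ ∑-cong (𝒴 (size r)) term ⟩
      ∑[ v ∈ 𝒴 (size r) ] (μ r v * ζ v u)         ≡⟨ isM r u (sym u~r) ⟩
      δ r u                                      ≡⟨ δ-≢ {r} {u} (λ { refl → r≰u ε }) ⟩
      0ℚ                                         ∎
      where
      open ≡-Reasoning
      vanishes : ∀ v → u ≢ v → μ r v * ζ v u ≡ 0ℚ
      vanishes v u≢v with zeta-view v u
      ... | unrelated vu _ = trans (cong (μ r v *_) vu) (ℚ.*-zeroʳ (μ r v))
      ... | related _ ¬¬v≤u =
        decidable-stable (μ r v * ζ v u ℚ.≟ 0ℚ) λ ≢0 → ¬¬v≤u λ v≤u →
          ≢0 (trans (cong (_* ζ v u) (go v (smaller (rank< v≤u)) (trans (size-≤T v≤u) u~r) (r≰u ∘ (_◅◅ v≤u))))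
                    (ℚ.*-zeroˡ (ζ v u)))
        where
        rank< : v ≤T u → rank v < rank u
        rank< v≤u with ≤T⇒≡⊎rank< v≤u
        ... | inj₁ refl = contradiction refl u≢v
        ... | inj₂ v<u = v<u
      term : ∀ v → δ u v * μ r u ≡ μ r v * ζ v u
      term v with u ≟T v
      ... | yes refl =
        trans (ℚ.*-identityˡ (μ r u)) (sym (trans (cong (μ r u *_) (ζ-refl u)) (ℚ.*-identityʳ (μ r u))))
      ... | no u≢v = trans (ℚ.*-zeroˡ (μ r u)) (sym (vanishes v u≢v))

  μ-ζ-absorb : ∀ {r v} → size v ≡ size r → μ r v * ζ r v ≡ μ r v
  μ-ζ-absorb {r} {v} v~r with zeta-view r v
  ... | related rv _ = trans (cong (μ r v *_) rv) (ℚ.*-identityʳ (μ r v))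
  ... | unrelated rv r≰v =
    trans (cong (μ r v *_) rv) (trans (ℚ.*-zeroʳ (μ r v)) (sym (μ-triangular v~r r≰v)))

  ∑-M-ζ : ∀ s x → ∑ (M ζ μ s) (λ (c , v) → c * ζ v x) ≡ δ s x
  ∑-M-ζ s x with size x ℕ.≟ size s
  ... | yes x~s = trans (∑-map (λ v → (μ s v * ζ s v , v)) (𝒴 (size s)) _)
                        (trans (∑-cong (𝒴 (size s)) absorb) (isM s x (sym x~s)))
    where
    absorb : ∀ v → μ s v * ζ s v * ζ v x ≡ μ s v * ζ v x
    absorb v with size v ℕ.≟ size s
    ... | yes v~s = cong (_* ζ v x) (μ-ζ-absorb v~s)
    ... | no v≁s = trans (cong (μ s v * ζ s v *_) vx)
                         (trans (ℚ.*-zeroʳ (μ s v * ζ s v)) (sym (trans (cong (μ s v *_) vx) (ℚ.*-zeroʳ (μ s v)))))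
      where
      vx : ζ v x ≡ 0ℚ
      vx = ζ-size (v≁s ∘ flip trans x~s)
  ... | no x≁s = trans (∑-map (λ v → (μ s v * ζ s v , v)) (𝒴 (size s)) _)
                       (trans (∑-zero (𝒴 (size s)) vanish) (sym (δ-≢ (x≁s ∘ cong size ∘ sym))))
    where
    vanish : ∀ v → μ s v * ζ s v * ζ v x ≡ 0ℚ
    vanish v with size v ℕ.≟ size s
    ... | yes v~s = trans (cong (μ s v * ζ s v *_) (ζ-size (x≁s ∘ flip trans v~s ∘ sym)))
                          (ℚ.*-zeroʳ (μ s v * ζ s v))
    ... | no v≁s = trans (cong (λ z → μ s v * z * ζ v x) (ζ-size (v≁s ∘ sym)))
                         (trans (cong (_* ζ v x) (ℚ.*-zeroʳ (μ s v))) (ℚ.*-zeroˡ (ζ v x)))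

  pairing-ΔM : ∀ r a b → pairing ζ (ΔM ζ μ r) a b ≡ δ r (a ＼ b)
  pairing-ΔM r a b = begin
    pairing ζ (ΔM ζ μ r) a b
      ≡⟨ ∑-concatMap _ (M ζ μ r) (weight ζ a b) ⟩
    ∑ (M ζ μ r) (λ (c , u) → pairing ζ (scale c (ΔF u)) a b)
      ≡⟨ ∑-cong (M ζ μ r) (λ (c , u) → trans (pairing-scale ζ c (ΔF u) a b) (cong (c *_) (pairing-ΔF u a b))) ⟩
    ∑ (M ζ μ r) (λ (c , u) → c * ζ u (a ＼ b))
      ≡⟨ ∑-M-ζ r (a ＼ b) ⟩
    δ r (a ＼ b) ∎
    where open ≡-Reasoning

  pairing-M⊗M : ∀ s t a b → pairing ζ (M⊗M ζ μ s t) a b ≡ δ s a * δ t b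
  pairing-M⊗M s t a b = begin
    pairing ζ (M⊗M ζ μ s t) a b
      ≡⟨ ∑-concatMap _ (M ζ μ s) (weight ζ a b) ⟩
    ∑ (M ζ μ s) (λ (c , s') → ∑ (map (λ (d , t') → (c * d , s' , t')) (M ζ μ t)) (weight ζ a b))
      ≡⟨ ∑-cong (M ζ μ s) (λ (c , s') → trans (∑-map _ (M ζ μ t) (weight ζ a b))
                                              (∑-cong (M ζ μ t) λ (d , t') → regroup c d (ζ s' a) (ζ t' b))) ⟩
    ∑ (M ζ μ s) (λ (c , s') → ∑ (M ζ μ t) (λ (d , t') → c * ζ s' a * (d * ζ t' b)))
      ≡⟨ ∑-cong (M ζ μ s) (λ (c , s') → trans (∑-*ˡ (c * ζ s' a) (M ζ μ t) _)
                                              (cong (c * ζ s' a *_) (∑-M-ζ t b))) ⟩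
    ∑ (M ζ μ s) (λ (c , s') → c * ζ s' a * δ t b)
      ≡⟨ trans (∑-*ʳ (δ t b) (M ζ μ s) _) (cong (_* δ t b) (∑-M-ζ s a)) ⟩
    δ s a * δ t b ∎
    where
    open ≡-Reasoning
    open +-*-Solver
    regroup : ∀ c d y z → c * d * y * z ≡ c * y * (d * z)
    regroup = solve 4 (λ c d y z → c :* d :* y :* z := c :* y :* (d :* z)) refl

  pairing-RHS : ∀ r a b → pairing ζ (RHS ζ μ r) a b ≡ δ r (a ＼ b)
  pairing-RHS r a b = begin
    pairing ζ (RHS ζ μ r) a b
      ≡⟨ ∑-concatMap _ (pairs＼ ζ μ r) (weight ζ a b) ⟩
    ∑ (pairs＼ ζ μ r) (λ (s , t) → pairing ζ (M⊗M ζ μ s t) a b)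
      ≡⟨ ∑-cong (pairs＼ ζ μ r) (λ (s , t) → pairing-M⊗M s t a b) ⟩
    ∑ (pairs＼ ζ μ r) (λ (s , t) → δ s a * δ t b)
      ≡⟨ ∑-filter _ splits _ ⟩
    ∑ splits (λ (s , t) → ind ((s ＼ t) ≟T r) * (δ s a * δ t b))
      ≡⟨ ∑-concatMap row (upTo (suc n)) _ ⟩
    ∑[ i ∈ upTo (suc n) ] ∑ (row i) (λ (s , t) → ind ((s ＼ t) ≟T r) * (δ s a * δ t b))
      ≡⟨ ∑-cong (upTo (suc n)) (λ i → trans (∑-concatMap (λ s → map (s ,_) (𝒴 (n ∸ i))) (𝒴 i) _)
           (∑-cong (𝒴 i) λ s → trans (∑-map (s ,_) (𝒴 (n ∸ i)) _)
             (∑-cong (𝒴 (n ∸ i)) λ t → δ-select s t a b (λ s t → ind ((s ＼ t) ≟T r))))) ⟩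
    ∑[ i ∈ upTo (suc n) ] ∑[ s ∈ 𝒴 i ] ∑[ t ∈ 𝒴 (n ∸ i) ] (δ a s * (δ b t * ind ((a ＼ b) ≟T r)))
      ≡⟨ ∑-splits-δ 𝒴 n (λ {i} _ → 𝒴-enumerates i) a b (λ _ _ → ind ((a ＼ b) ≟T r)) ⟩
    ind (size a ℕ.+ size b ℕ.≟ n) * ind ((a ＼ b) ≟T r)
      ≡⟨ only-if-sizes-add-up ((a ＼ b) ≟T r) ⟩
    δ r (a ＼ b) ∎
    where
    open ≡-Reasoning
    n : ℕ
    n = size r
    row : ℕ → List (Tree × Tree)
    row i = concatMap (λ s → map (s ,_) (𝒴 (n ∸ i))) (𝒴 i)
    splits : List (Tree × Tree)
    splits = concatMap row (upTo (suc n))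
    only-if-sizes-add-up : (r? : Dec ((a ＼ b) ≡ r)) →
                           ind (size a ℕ.+ size b ℕ.≟ n) * ind r? ≡ δ r (a ＼ b)
    only-if-sizes-add-up (yes refl) =
      trans (cong (_* 1ℚ) (ind-yes (size a ℕ.+ size b ℕ.≟ n) (sym (size-＼ a b)))) (sym (δ-refl (a ＼ b)))
    only-if-sizes-add-up (no ≢r) =
      trans (ℚ.*-zeroʳ (ind (size a ℕ.+ size b ℕ.≟ n))) (sym (δ-≢ (≢r ∘ sym)))

theorem5p1 : (ζ μ : Tree → Tree → ℚ) → IsZeta ζ → IsMöbius ζ μ →
    ∀ (r a b : Tree) → coeff (ΔM ζ μ r) a b ≡ coeff (RHS ζ μ r) a b
theorem5p1 ζ μ isZ isM r =
  pairing-injective (ΔM ζ μ r) (RHS ζ μ r) λ a b → trans (pairing-ΔM r a b) (sym (pairing-RHS r a b))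
  where
  open Zeta ζ isZ
  open Möbius ζ μ isZ isM
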